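{- Let $r\ge3$ and let $P_I$ be as in the context. For all integers $t\ge s\ge r$, $\Lambda_{P_I}(s)/\binom sr\ge\Lambda_{P_I}(t)/\binom tr$.
   Context: Patterns and blowups: an $r$-graph pattern is $P=(m,E,R)$ with $E$ a collection of $r$-multisets on $[m]$ and $R\subseteq[m]$; for disjoint $V_1,\dots,V_m$, $E(V_1,\dots,V_m)$ is the $r$-graph of all $r$-subsets of $\bigcup V_i$ whose profile (the multiset on $[m]$ with multiplicities $|X\cap V_i|$) lies in $E$. For $P_I=\{P_i=(m_i,E_i,R_i)\colon i\in I\}$, a $P_I$-mixing construction on $V$ is an edgeless $r$-graph on $V$, or one obtained by choosing $i\in I$ and a partition $V=V_1\cup\dots\cup V_{m_i}$ with $V_j\neq V$ for $j\in R_i$, taking $E_i(V_1,\dots,V_{m_i})$, and adding for each $j\in R_i$ an arbitrary $P_I$-mixing construction on $V_j$. $\Lambda_{P_I}(n)$ is the maximum number of edges of a $P_I$-mixing construction on $[n]$. $\lambda_P$ (Lagrangian of a single pattern) is $\lim_n\Lambda_{\{P\}}(n)/\binom nr$; $P-j$ is obtained by deleting index $j$ and all multisets containing it; $P$ is minimal if $\lambda_{P-j}<\lambda_P$ for all $j$. Standing assumptions: $I$ is finite and non-empty, the patterns $P_i$ are pairwise non-isomorphic, and each $P_i$ is minimal with $0<\lambda_{P_i}<1$. -}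

module Defs where

open import Data.Bool using (Bool; true; false; _∧_; _∨_; if_then_else_; T)
open import Data.Nat using (ℕ; zero; suc; _+_; _*_; _≤_; _≡ᵇ_)
open import Data.Nat.Combinatorics using (_C_)
import Data.Nat as ℕ
open import Data.Fin using (Fin)
import Data.Fin as F
open import Data.Fin.Subset using (Subset; _∈_; ∣_∣; ⊤)
open import Data.Fin.Permutation using (Permutation; _⟨$⟩ʳ_; _⟨$⟩ˡ_)
open import Data.Vec using (Vec; []; _∷_; lookup; tabulate; removeAt)
import Data.Vec.Properties as VP
open import Data.List using (List; []; _∷_; map; _++_; allFin; filterᵇ)
open import Data.Nat.ListAction using (sum)
open import Data.Bool.ListAction using (any; all)
open import Data.List.Relation.Unary.All using (All)
open import Data.Product using (Σ; _×_; ∃)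
open import Relation.Nullary using (does; ¬_)
open import Relation.Binary.PropositionalEquality using (_≡_; _≢_)

-- Patterns.  An r-multiset on [m] is a vector of multiplicities
-- (Vec ℕ m) summing to r; E is a finite collection of them; R ⊆ [m].

record Pattern : Set where
  constructor pat
  field
    m : ℕ
    E : List (Vec ℕ m)
    R : Subset m
open Pattern public

IsRPattern : ℕ → Pattern → Set
IsRPattern r P = All (λ v → sum (Data.Vec.toList v) ≡ r) (E P)
  where import Data.Vec

memE : ∀ {m} → Vec ℕ m → List (Vec ℕ m) → Bool
memE v es = any (λ w → does (VP.≡-dec ℕ._≟_ v w)) es

_-ᵖ_ : (P : Pattern) → Fin (m P) → Pattern
pat zero E R -ᵖ ()
pat (suc m) E R -ᵖ j =
  pat m (map (λ v → removeAt v j) (filterᵇ (λ v → lookup v j ≡ᵇ 0) E)) (removeAt R j)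

permV : ∀ {m m'} → Permutation m m' → Vec ℕ m → Vec ℕ m'
permV σ v = tabulate (λ j' → lookup v (σ ⟨$⟩ˡ j'))

PatIso : Pattern → Pattern → Set
PatIso P Q = Σ (Permutation (m P) (m Q)) λ σ →
  ((v : Vec ℕ (m P)) → (T (memE v (E P)) → T (memE (permV σ v) (E Q)))
                      × (T (memE (permV σ v) (E Q)) → T (memE v (E P))))
  × ((j : Fin (m P)) → (j ∈ R P → (σ ⟨$⟩ʳ j) ∈ R Q) × ((σ ⟨$⟩ʳ j) ∈ R Q → j ∈ R P))

Graph : ℕ → Set
Graph n = Subset n → Bool

allSubsets : (n : ℕ) → List (Subset n)
allSubsets zero = [] ∷ []
allSubsets (suc n) = map (true ∷_) (allSubsets n) ++ map (false ∷_) (allSubsets n)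

edges : ∀ {n} → Graph n → ℕ
edges {n} G = sum (map (λ X → if G X then 1 else 0) (allSubsets n))

_⊆ᵇ_ : ∀ {n} → Subset n → Subset n → Bool
_⊆ᵇ_ {n} X V = all (λ x → if lookup X x then lookup V x else true) (allFin n)

-- The part V_j of V for a partition given by an assignment part : Fin n → Fin m
-- (only its values on V matter; parts may be empty).
block : ∀ {n m} → Subset n → (Fin n → Fin m) → Fin m → Subset n
block V part j = tabulate (λ x → lookup V x ∧ does (part x F.≟ j))

profile : ∀ {n m} → (Fin n → Fin m) → Subset n → Vec ℕ m
profile {n} part X = tabulate (λ j →
  sum (map (λ x → if lookup X x ∧ does (part x F.≟ j) then 1 else 0) (allFin n)))

blowupEdge : ∀ {n} → ℕ → (P : Pattern) → Subset n → (Fin n → Fin (m P)) → Subset n → Bool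
blowupEdge r P V part X = (∣ X ∣ ≡ᵇ r) ∧ (X ⊆ᵇ V) ∧ memE (profile part X) (E P)

unionR : ∀ {n m} → Subset m → (Fin m → Graph n) → Graph n
unionR {m = m} R H X = any (λ j → lookup R j ∧ H j X) (allFin m)

data Mix (r : ℕ) {k : ℕ} (Ps : Fin k → Pattern) {n : ℕ} : Subset n → Graph n → Set where
  edgeless : ∀ {V G} → (∀ X → G X ≡ false) → Mix r Ps V G
  step : ∀ {V G} (i : Fin k) (part : Fin n → Fin (m (Ps i)))
         (H : Fin (m (Ps i)) → Graph n) →
         (∀ j → j ∈ R (Ps i) → block V part j ≢ V) →
         (∀ j → j ∈ R (Ps i) → Mix r Ps (block V part j) (H j)) →
         (∀ X → G X ≡ (blowupEdge r (Ps i) V part X ∨ unionR (R (Ps i)) H X)) →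
         Mix r Ps V G

IsΛ : (r : ℕ) {k : ℕ} → (Fin k → Pattern) → ℕ → ℕ → Set
IsΛ r Ps n a = (∃ λ G → Mix r Ps ⊤ G × edges {n} G ≡ a)
             × (∀ G → Mix r Ps ⊤ G → edges {n} G ≤ a)

single : Pattern → Fin 1 → Pattern
single P _ = P

-- Lagrangians λ_P = lim Λ_{{P}}(n)/C(n,r), compared via the standard
-- order on limits of rational sequences: lim x < lim y iff there are
-- q ≥ 1 and N with x_n + 1/q ≤ y_n for all n ≥ N (cross-multiplied).

LagPos : ℕ → Pattern → Set
LagPos r P = ∃ λ q → 1 ≤ q × ∃ λ N → ∀ n → N ≤ n → ∀ a →
  IsΛ r (single P) n a → (n C r) ≤ q * a

LagLt1 : ℕ → Pattern → Set
LagLt1 r P = ∃ λ q → 1 ≤ q × ∃ λ N → ∀ n → N ≤ n → ∀ a →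
  IsΛ r (single P) n a → q * a + (n C r) ≤ q * (n C r)

LagLess : ℕ → Pattern → Pattern → Set
LagLess r Q P = ∃ λ q → 1 ≤ q × ∃ λ N → ∀ n → N ≤ n → ∀ a b →
  IsΛ r (single Q) n a → IsΛ r (single P) n b → q * a + (n C r) ≤ q * b

Minimal : ℕ → Pattern → Set
Minimal r P = ∀ j → LagLess r (P -ᵖ j) P

-- Deleting a vertex v from a P_I-mixing construction G on [n + 1] leaves a P_I-mixing
-- construction G − v on [n]. The only delicate case is a step whose remaining vertices all fall
-- into one recursive part V_k: the top level must then be dropped, which loses no edge because
-- λ_P < 1 forbids the profile r·{k} in P (otherwise one vertex outside V_k would already give
-- density tending to 1). Every edge of G survives exactly the n + 1 − r deletions of vertices
-- outside it, so (n + 1 − r) |G| ≤ (n + 1) Λ(n), i.e. Λ(n + 1)/C(n + 1, r) ≤ Λ(n)/C(n, r),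
-- and the theorem follows by induction on t.

module Submission where

open import Defs
open import Data.Bool using (Bool; true; false; _∧_; _∨_; if_then_else_)
import Data.Bool as Bool
open import Data.Bool.Properties using (T-≡)
open import Data.Bool.ListAction using (any; all; and)
open import Data.Empty using (⊥; ⊥-elim)
open import Data.Fin using (Fin; zero; suc; punchIn)
import Data.Fin as F
import Data.Fin.Properties as FinP
open import Data.Fin.Subset using (Subset; ∣_∣; ⊤; _∈_)
open import Data.Fin.Subset.Properties using (_∈?_)
open import Data.List using (List; []; _∷_; map; allFin; tabulate; length)
import Data.List.Properties as ListP
open import Data.List.Membership.Propositional.Properties using (∈-allFin)
import Data.List.Relation.Unary.All as All
open import Data.List.Relation.Unary.All.Properties using (all⁺; all⁻)
import Data.List.Relation.Unary.Any as Any
open import Data.List.Relation.Unary.Any.Properties using (any⁺; any⁻)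
open import Data.Nat using (ℕ; zero; suc; _+_; _*_; _∸_; _≤_; _<_; _≡ᵇ_; z≤n; s≤s; >-nonZero)
open import Data.Nat.Properties
open import Data.Nat.Combinatorics using (_C_; nCk+nC[k+1]≡[n+1]C[k+1]; nCk≡nC[n∸k]; nC1≡n; k>n⇒nCk≡0)
open import Data.Nat.ListAction using (sum)
open import Data.Nat.ListAction.Properties using (sum-++)
open import Data.Nat.Tactic.RingSolver using (solve-∀)
open import Data.Product using (_×_; ∃; _,_; proj₁; proj₂)
open import Data.Sum using (_⊎_; inj₁; inj₂)
open import Data.Vec using (Vec; []; _∷_; lookup; insertAt; removeAt)
import Data.Vec as Vec
import Data.Vec.Properties as VecP
open import Function using (_∘_; id; Equivalence)
open import Relation.Nullary using (¬_; Dec; does; yes; no)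
open import Relation.Nullary.Decidable using (dec-true; dec-false; _×-dec_; ¬?)
open import Relation.Nullary.Decidable.Core using (¬¬-excluded-middle)
open import Relation.Binary.PropositionalEquality

indicator : Bool → ℕ
indicator b = if b then 1 else 0

sum-map-+ : ∀ {A : Set} (xs : List A) (f g : A → ℕ) →
  sum (map (λ x → f x + g x) xs) ≡ sum (map f xs) + sum (map g xs)
sum-map-+ [] f g = refl
sum-map-+ (x ∷ xs) f g = trans (cong (f x + g x +_) (sum-map-+ xs f g)) (+-interchange (f x) (g x) _ _)
  where
  +-interchange : ∀ a b c d → a + b + (c + d) ≡ a + c + (b + d)
  +-interchange = solve-∀

sum-map-*ˡ : ∀ {A : Set} (xs : List A) c (f : A → ℕ) → sum (map (λ x → c * f x) xs) ≡ c * sum (map f xs)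
sum-map-*ˡ [] c f = sym (*-zeroʳ c)
sum-map-*ˡ (x ∷ xs) c f = trans (cong (c * f x +_) (sum-map-*ˡ xs c f)) (sym (*-distribˡ-+ c (f x) _))

sum-map-cong : ∀ {A : Set} (xs : List A) {f g : A → ℕ} → (∀ x → f x ≡ g x) → sum (map f xs) ≡ sum (map g xs)
sum-map-cong xs f≗g = cong sum (ListP.map-cong f≗g xs)

sum-map-mono : ∀ {A : Set} (xs : List A) {f g : A → ℕ} → (∀ x → f x ≤ g x) → sum (map f xs) ≤ sum (map g xs)
sum-map-mono [] f≤g = z≤n
sum-map-mono (x ∷ xs) f≤g = +-mono-≤ (f≤g x) (sum-map-mono xs f≤g)

sum-map-zero : ∀ {A : Set} (xs : List A) → sum (map (λ _ → 0) xs) ≡ 0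
sum-map-zero [] = refl
sum-map-zero (x ∷ xs) = sum-map-zero xs

sum-map-indicator≤length : ∀ {A : Set} (xs : List A) (p : A → Bool) → sum (map (indicator ∘ p) xs) ≤ length xs
sum-map-indicator≤length [] p = z≤n
sum-map-indicator≤length (x ∷ xs) p with p x
... | true = s≤s (sum-map-indicator≤length xs p)
... | false = m≤n⇒m≤1+n (sum-map-indicator≤length xs p)

sum-allFin : ∀ n (f : Fin n → ℕ) → sum (map f (allFin n)) ≡ sum (tabulate f)
sum-allFin n f = cong sum (ListP.map-tabulate id f)

sum-tabulate-punchIn : ∀ {n} (f : Fin (suc n) → ℕ) v → sum (tabulate f) ≡ f v + sum (tabulate (f ∘ punchIn v))
sum-tabulate-punchIn f zero = refl
sum-tabulate-punchIn {suc n} f (suc w) =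
  trans (cong (f zero +_) (sum-tabulate-punchIn (f ∘ suc) w)) (x+[y+z]≡y+[x+z] (f zero) (f (suc w)) _)
  where
  x+[y+z]≡y+[x+z] : ∀ x y z → x + (y + z) ≡ y + (x + z)
  x+[y+z]≡y+[x+z] = solve-∀

sum-tabulate-+ : ∀ {n} (f g : Fin n → ℕ) → sum (tabulate (λ x → f x + g x)) ≡ sum (tabulate f) + sum (tabulate g)
sum-tabulate-+ {n} f g = begin
  sum (tabulate (λ x → f x + g x))                      ≡⟨ sum-allFin n _ ⟨
  sum (map (λ x → f x + g x) (allFin n))                ≡⟨ sum-map-+ (allFin n) f g ⟩
  sum (map f (allFin n)) + sum (map g (allFin n))       ≡⟨ cong₂ _+_ (sum-allFin n f) (sum-allFin n g) ⟩
  sum (tabulate f) + sum (tabulate g)                   ∎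
  where open ≡-Reasoning

sum-tabulate-*≤ : ∀ {n} (g : Fin n → ℕ) K B → (∀ v → g v * K ≤ B) → sum (tabulate g) * K ≤ n * B
sum-tabulate-*≤ {zero} g K B gK≤B = z≤n
sum-tabulate-*≤ {suc n} g K B gK≤B = subst (_≤ suc n * B) (sym (*-distribʳ-+ K (g zero) _))
  (+-mono-≤ (gK≤B zero) (sum-tabulate-*≤ (g ∘ suc) K B (gK≤B ∘ suc)))

sumSubsets : ∀ n → (Subset n → ℕ) → ℕ
sumSubsets n f = sum (map f (allSubsets n))

sumSubsets-suc : ∀ n f → sumSubsets (suc n) f ≡ sumSubsets n (f ∘ (true ∷_)) + sumSubsets n (f ∘ (false ∷_))
sumSubsets-suc n f = begin
  sum (map f (map (true ∷_) Ss ++ map (false ∷_) Ss))           ≡⟨ cong sum (ListP.map-++ f (map (true ∷_) Ss) _) ⟩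
  sum (map f (map (true ∷_) Ss) ++ map f (map (false ∷_) Ss))   ≡⟨ sum-++ (map f (map (true ∷_) Ss)) _ ⟩
  sum (map f (map (true ∷_) Ss)) + sum (map f (map (false ∷_) Ss))
    ≡⟨ cong₂ _+_ (cong sum (ListP.map-∘ Ss)) (cong sum (ListP.map-∘ Ss)) ⟨
  sumSubsets n (f ∘ (true ∷_)) + sumSubsets n (f ∘ (false ∷_))   ∎
  where
  open ≡-Reasoning
  open Data.List using (_++_)
  Ss = allSubsets n

∨≡true⇒ : ∀ {a b} → a ∨ b ≡ true → a ≡ true ⊎ b ≡ true
∨≡true⇒ {true} _ = inj₁ refl
∨≡true⇒ {false} b≡true = inj₂ b≡true


∧≡true⇒ : ∀ {a b} → a ∧ b ≡ true → a ≡ true × b ≡ true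
∧≡true⇒ {true} {true} _ = refl , refl

≡true⇔≡true⇒≡ : ∀ {a b : Bool} → (a ≡ true → b ≡ true) → (b ≡ true → a ≡ true) → a ≡ b
≡true⇔≡true⇒≡ {true} a⇒b _ = sym (a⇒b refl)
≡true⇔≡true⇒≡ {false} {true} _ b⇒a = b⇒a refl
≡true⇔≡true⇒≡ {false} {false} _ _ = refl

≡ᵇ≡true⇒≡ : ∀ {a b} → (a ≡ᵇ b) ≡ true → a ≡ b
≡ᵇ≡true⇒≡ {a} {b} e = ≡ᵇ⇒≡ a b (Equivalence.from T-≡ e)

does≡true⇒ : ∀ {A : Set} (d : Dec A) → does d ≡ true → A
does≡true⇒ (yes a) _ = a

any≡true⇒ : ∀ {A : Set} (p : A → Bool) xs → any p xs ≡ true → ∃ λ x → p x ≡ true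
any≡true⇒ p xs e with Any.satisfied (any⁻ p xs (Equivalence.from T-≡ e))
... | x , px = x , Equivalence.to T-≡ px

any-allFin≡true : ∀ {n} (p : Fin n → Bool) x → p x ≡ true → any p (allFin n) ≡ true
any-allFin≡true p x px = Equivalence.to T-≡ (any⁺ p (Any.map (λ { refl → Equivalence.from T-≡ px }) (∈-allFin x)))

all-allFin≡true⇒ : ∀ {n} (p : Fin n → Bool) → all p (allFin n) ≡ true → ∀ x → p x ≡ true
all-allFin≡true⇒ {n} p e x = Equivalence.to T-≡ (All.lookup (all⁺ p (allFin n) (Equivalence.from T-≡ e)) (∈-allFin x))

all-allFin≡true : ∀ {n} (p : Fin n → Bool) → (∀ x → p x ≡ true) → all p (allFin n) ≡ true
all-allFin≡true p px = Equivalence.to T-≡ (all⁻ p {allFin _} (All.tabulate λ {x} _ → Equivalence.from T-≡ (px x)))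

all-allFin≡and-tabulate : ∀ n (f : Fin n → Bool) → all f (allFin n) ≡ and (tabulate f)
all-allFin≡and-tabulate n f = cong and (ListP.map-tabulate id f)

and-tabulate-punchIn : ∀ {n} (f : Fin (suc n) → Bool) v → and (tabulate f) ≡ f v ∧ and (tabulate (f ∘ punchIn v))
and-tabulate-punchIn f zero = refl
and-tabulate-punchIn {suc n} f (suc w) =
  trans (cong (f zero ∧_) (and-tabulate-punchIn (f ∘ suc) w)) (∧-swap (f zero) (f (suc w)) _)
  where
  ∧-swap : ∀ a b c → a ∧ (b ∧ c) ≡ b ∧ (a ∧ c)
  ∧-swap true b c = refl
  ∧-swap false true c = refl
  ∧-swap false false c = refl

lookup-extensionality : ∀ {A : Set} {n} (xs ys : Vec A n) → (∀ i → lookup xs i ≡ lookup ys i) → xs ≡ ys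
lookup-extensionality xs ys xs≗ys =
  trans (sym (VecP.tabulate∘lookup xs)) (trans (VecP.tabulate-cong xs≗ys) (VecP.tabulate∘lookup ys))

lookup-removeAt : ∀ {A : Set} {n} (xs : Vec A (suc n)) v x → lookup (removeAt xs v) x ≡ lookup xs (punchIn v x)
lookup-removeAt (y ∷ xs) zero x = refl
lookup-removeAt (y ∷ z ∷ xs) (suc v) zero = refl
lookup-removeAt (y ∷ z ∷ xs) (suc v) (suc x) = lookup-removeAt (z ∷ xs) v x

∣insertAt-false∣ : ∀ {n} (X : Subset n) v → ∣ insertAt X v false ∣ ≡ ∣ X ∣
∣insertAt-false∣ X zero = refl
∣insertAt-false∣ (true ∷ X) (suc v) = cong suc (∣insertAt-false∣ X v)
∣insertAt-false∣ (false ∷ X) (suc v) = ∣insertAt-false∣ X v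

removeAt-⊤ : ∀ n (v : Fin (suc n)) → removeAt (⊤ {suc n}) v ≡ ⊤
removeAt-⊤ n zero = refl
removeAt-⊤ (suc n) (suc v) = cong (true ∷_) (removeAt-⊤ n v)

∣∣≡sum-indicator : ∀ {n} (X : Subset n) → ∣ X ∣ ≡ sum (map (indicator ∘ lookup X) (allFin n))
∣∣≡sum-indicator {n} X = trans (∣∣≡sum-tabulate X) (sym (sum-allFin n _))
  where
  ∣∣≡sum-tabulate : ∀ {n} (X : Subset n) → ∣ X ∣ ≡ sum (tabulate (indicator ∘ lookup X))
  ∣∣≡sum-tabulate [] = refl
  ∣∣≡sum-tabulate (true ∷ X) = cong suc (∣∣≡sum-tabulate X)
  ∣∣≡sum-tabulate (false ∷ X) = ∣∣≡sum-tabulate X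

∣∣≡0 : ∀ {n} (X : Subset n) → (∀ x → lookup X x ≡ true → ⊥) → ∣ X ∣ ≡ 0
∣∣≡0 [] _ = refl
∣∣≡0 (true ∷ X) X-empty = ⊥-elim (X-empty zero refl)
∣∣≡0 (false ∷ X) X-empty = ∣∣≡0 X (X-empty ∘ suc)

⊆ᵇ≡true⇒ : ∀ {n} (X V : Subset n) → (X ⊆ᵇ V) ≡ true → ∀ x → lookup X x ≡ true → lookup V x ≡ true
⊆ᵇ≡true⇒ X V X⊆V x x∈X with all-allFin≡true⇒ _ X⊆V x
... | x∈V rewrite x∈X = x∈V

⊆ᵇ⊤ : ∀ {n} (X : Subset n) → (X ⊆ᵇ ⊤) ≡ true
⊆ᵇ⊤ {n} X = all-allFin≡true _ λ x → if-true (lookup X x) (VecP.lookup-replicate x true)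
  where
  if-true : ∀ b {c} → c ≡ true → (if b then c else true) ≡ true
  if-true true c≡true = c≡true
  if-true false _ = refl

insertAt-false-⊆ᵇ : ∀ {n} (X : Subset n) (V : Subset (suc n)) v → (insertAt X v false ⊆ᵇ V) ≡ (X ⊆ᵇ removeAt V v)
insertAt-false-⊆ᵇ {n} X V v = begin
  all f (allFin (suc n))                                    ≡⟨ all-allFin≡and-tabulate (suc n) f ⟩
  and (tabulate f)                                          ≡⟨ and-tabulate-punchIn f v ⟩
  f v ∧ and (tabulate (f ∘ punchIn v))                      ≡⟨ cong₂ _∧_ f-at-v (cong and (ListP.tabulate-cong f∘punchIn≗g)) ⟩
  true ∧ and (tabulate g)                                   ≡⟨ all-allFin≡and-tabulate n g ⟨
  all g (allFin n)                                          ∎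
  where
  open ≡-Reasoning
  f : Fin (suc n) → Bool
  f x = if lookup (insertAt X v false) x then lookup V x else true
  g : Fin n → Bool
  g x = if lookup X x then lookup (removeAt V v) x else true
  f-at-v : f v ≡ true
  f-at-v rewrite VecP.insertAt-lookup X v false = refl
  f∘punchIn≗g : ∀ x → f (punchIn v x) ≡ g x
  f∘punchIn≗g x rewrite VecP.insertAt-punchIn X v false x | lookup-removeAt V v x = refl

lookup-block : ∀ {n m} (V : Subset n) (part : Fin n → Fin m) j x →
  lookup (block V part j) x ≡ (lookup V x ∧ does (part x F.≟ j))
lookup-block V part j x = VecP.lookup∘tabulate _ x

block-removeAt : ∀ {n m} (V : Subset (suc n)) (part : Fin (suc n) → Fin m) v j →
  block (removeAt V v) (part ∘ punchIn v) j ≡ removeAt (block V part j) v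
block-removeAt V part v j = lookup-extensionality _ _ λ x → begin
  lookup (block (removeAt V v) (part ∘ punchIn v) j) x            ≡⟨ lookup-block (removeAt V v) (part ∘ punchIn v) j x ⟩
  lookup (removeAt V v) x ∧ does (part (punchIn v x) F.≟ j)     ≡⟨ cong (_∧ _) (lookup-removeAt V v x) ⟩
  lookup V (punchIn v x) ∧ does (part (punchIn v x) F.≟ j)      ≡⟨ lookup-block V part j (punchIn v x) ⟨
  lookup (block V part j) (punchIn v x)                           ≡⟨ lookup-removeAt (block V part j) v x ⟨
  lookup (removeAt (block V part j) v) x                          ∎
  where open ≡-Reasoning

block≢⇒∃-other-part : ∀ {n m} (V : Subset n) (part : Fin n → Fin m) k → block V part k ≢ V →
  ∃ λ x → lookup V x ≡ true × part x ≢ k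
block≢⇒∃-other-part V part k block≢V
  with FinP.any? (λ x → (lookup V x Bool.≟ true) ×-dec ¬? (part x F.≟ k))
... | yes witness = witness
... | no none = ⊥-elim (block≢V (lookup-extensionality _ _ λ x → trans (lookup-block V part k x) (in-block x)))
  where
  in-block : ∀ x → (lookup V x ∧ does (part x F.≟ k)) ≡ lookup V x
  in-block x with lookup V x in x∈V
  ... | false = refl
  ... | true with part x F.≟ k
  ...   | yes _ = refl
  ...   | no part≢k = ⊥-elim (none (x , x∈V , part≢k))

profile-insertAt-false : ∀ {n m} (part : Fin (suc n) → Fin m) (X : Subset n) v →
  profile part (insertAt X v false) ≡ profile (part ∘ punchIn v) X
profile-insertAt-false {n} part X v = VecP.tabulate-cong λ j → begin
  sum (map (f j) (allFin (suc n)))                     ≡⟨ sum-allFin (suc n) (f j) ⟩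
  sum (tabulate (f j))                                 ≡⟨ sum-tabulate-punchIn (f j) v ⟩
  f j v + sum (tabulate (f j ∘ punchIn v))             ≡⟨ cong₂ _+_ (f-at-v j) (cong sum (ListP.tabulate-cong (f∘punchIn≗g j))) ⟩
  sum (tabulate (g j))                                 ≡⟨ sum-allFin n (g j) ⟨
  sum (map (g j) (allFin n))                           ∎
  where
  open ≡-Reasoning
  f : Fin _ → Fin (suc n) → ℕ
  f j x = if lookup (insertAt X v false) x ∧ does (part x F.≟ j) then 1 else 0
  g : Fin _ → Fin n → ℕ
  g j x = if lookup X x ∧ does (part (punchIn v x) F.≟ j) then 1 else 0
  f-at-v : ∀ j → f j v ≡ 0
  f-at-v j rewrite VecP.insertAt-lookup X v false = refl
  f∘punchIn≗g : ∀ j x → f j (punchIn v x) ≡ g j x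
  f∘punchIn≗g j x rewrite VecP.insertAt-punchIn X v false x = refl

blowupEdge-insertAt-false : ∀ {n} r P (V : Subset (suc n)) part (X : Subset n) v →
  blowupEdge r P V part (insertAt X v false) ≡ blowupEdge r P (removeAt V v) (part ∘ punchIn v) X
blowupEdge-insertAt-false r P V part X v
  rewrite ∣insertAt-false∣ X v | insertAt-false-⊆ᵇ X V v | profile-insertAt-false part X v = refl

pointMass : ∀ {m} → ℕ → Fin m → Vec ℕ m
pointMass c k = Vec.tabulate (λ j → if does (k F.≟ j) then c else 0)

profile-pointMass : ∀ {n m} (part : Fin n → Fin m) (X : Subset n) k →
  (∀ x → lookup X x ≡ true → part x ≡ k) → profile part X ≡ pointMass ∣ X ∣ k
profile-pointMass {n} part X k X⊆Vₖ = VecP.tabulate-cong λ j → multiplicity j (k F.≟ j)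
  where
  multiplicity : ∀ j (k≟j : Dec (k ≡ j)) →
    sum (map (λ x → if lookup X x ∧ does (part x F.≟ j) then 1 else 0) (allFin n)) ≡ (if does k≟j then ∣ X ∣ else 0)
  multiplicity j (yes refl) = trans (sum-map-cong (allFin n) in-Vₖ) (sym (∣∣≡sum-indicator X))
    where
    in-Vₖ : ∀ x → (if lookup X x ∧ does (part x F.≟ k) then 1 else 0) ≡ indicator (lookup X x)
    in-Vₖ x with lookup X x in x∈X
    ... | true rewrite dec-true (part x F.≟ k) (X⊆Vₖ x x∈X) = refl
    ... | false = refl
  multiplicity j (no k≢j) = trans (sum-map-cong (allFin n) outside-Vⱼ) (sum-map-zero (allFin n))
    where
    outside-Vⱼ : ∀ x → (if lookup X x ∧ does (part x F.≟ j) then 1 else 0) ≡ 0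
    outside-Vⱼ x with lookup X x in x∈X
    ... | true rewrite dec-false (part x F.≟ j) (λ part≡j → k≢j (trans (sym (X⊆Vₖ x x∈X)) part≡j)) = refl
    ... | false = refl

[1+k]*[1+n]C[1+k]≡[1+n]*nCk : ∀ n k → suc k * (suc n C suc k) ≡ suc n * (n C k)
[1+k]*[1+n]C[1+k]≡[1+n]*nCk zero zero = refl
[1+k]*[1+n]C[1+k]≡[1+n]*nCk zero (suc k)
  rewrite k>n⇒nCk≡0 {1} {suc (suc k)} (s≤s (s≤s z≤n)) | k>n⇒nCk≡0 {0} {suc k} (s≤s z≤n) = *-zeroʳ (suc (suc k))
[1+k]*[1+n]C[1+k]≡[1+n]*nCk (suc n) zero
  rewrite nC1≡n (suc (suc n)) = cong (λ z → suc (suc z)) (trans (+-identityʳ n) (sym (*-identityʳ n)))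
[1+k]*[1+n]C[1+k]≡[1+n]*nCk (suc n) (suc k) = begin
  suc (suc k) * (suc (suc n) C suc (suc k))
    ≡⟨ cong (suc (suc k) *_) (nCk+nC[k+1]≡[n+1]C[k+1] (suc n) (suc k)) ⟨
  suc (suc k) * (suc n C suc k + suc n C suc (suc k))
    ≡⟨ *-distribˡ-+ (suc (suc k)) (suc n C suc k) _ ⟩
  suc n C suc k + suc k * (suc n C suc k) + suc (suc k) * (suc n C suc (suc k))
    ≡⟨ cong₂ _+_ (cong (suc n C suc k +_) ([1+k]*[1+n]C[1+k]≡[1+n]*nCk n k)) ([1+k]*[1+n]C[1+k]≡[1+n]*nCk n (suc k)) ⟩
  suc n C suc k + suc n * (n C k) + suc n * (n C suc k)
    ≡⟨ regroup (suc n C suc k) (suc n) (n C k) (n C suc k) ⟩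
  suc n C suc k + suc n * (n C k + n C suc k)
    ≡⟨ cong (λ z → suc n C suc k + suc n * z) (nCk+nC[k+1]≡[n+1]C[k+1] n k) ⟩
  suc (suc n) * (suc n C suc k) ∎
  where
  open ≡-Reasoning
  regroup : ∀ a b c d → a + b * c + b * d ≡ a + b * (c + d)
  regroup = solve-∀

nCk>0 : ∀ {n k} → k ≤ n → 0 < n C k
nCk>0 {n} {zero} _ = ≤-refl
nCk>0 {suc n} {suc k} (s≤s k≤n) = subst (0 <_) (nCk+nC[k+1]≡[n+1]C[k+1] n k) (≤-trans (nCk>0 k≤n) (m≤m+n _ _))

[1+r+d]*[r+d]Cr≡[1+d]*[1+r+d]Cr : ∀ r d → suc (r + d) * ((r + d) C r) ≡ suc d * (suc (r + d) C r)
[1+r+d]*[r+d]Cr≡[1+d]*[1+r+d]Cr r d = begin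
  suc (r + d) * ((r + d) C r)                ≡⟨ cong (suc (r + d) *_) (nCk≡nC[n∸k] (m≤m+n r d)) ⟩
  suc (r + d) * ((r + d) C ((r + d) ∸ r))    ≡⟨ cong (λ z → suc (r + d) * ((r + d) C z)) (m+n∸m≡n r d) ⟩
  suc (r + d) * ((r + d) C d)                ≡⟨ [1+k]*[1+n]C[1+k]≡[1+n]*nCk (r + d) d ⟨
  suc d * (suc (r + d) C suc d)              ≡⟨ cong (λ z → suc d * (suc (r + d) C z)) [1+r+d]∸r≡1+d ⟨
  suc d * (suc (r + d) C (suc (r + d) ∸ r))  ≡⟨ cong (suc d *_) (nCk≡nC[n∸k] (≤-trans (m≤m+n r d) (n≤1+n _))) ⟨
  suc d * (suc (r + d) C r)                  ∎
  where
  open ≡-Reasoning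
  [1+r+d]∸r≡1+d : suc (r + d) ∸ r ≡ suc d
  [1+r+d]∸r≡1+d = trans (cong (_∸ r) (sym (+-suc r d))) (m+n∸m≡n r (suc d))

sumSubsets-size≡C : ∀ n r → sumSubsets n (λ Y → indicator (∣ Y ∣ ≡ᵇ r)) ≡ n C r
sumSubsets-size≡C zero zero = refl
sumSubsets-size≡C zero (suc r) = refl
sumSubsets-size≡C (suc n) zero = trans (sumSubsets-suc n _) (cong₂ _+_ (sum-map-zero (allSubsets n)) (sumSubsets-size≡C n zero))
sumSubsets-size≡C (suc n) (suc r) = trans (sumSubsets-suc n _)
  (trans (cong₂ _+_ (sumSubsets-size≡C n r) (sumSubsets-size≡C n (suc r))) (nCk+nC[k+1]≡[n+1]C[k+1] n r))

deletionSum : ∀ n → (Subset (suc n) → ℕ) → ℕ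
deletionSum n f = sum (tabulate (λ v → sumSubsets n (λ X → f (insertAt X v false))))

sizeWeightedSum : ∀ n → (Subset n → ℕ) → ℕ
sizeWeightedSum n f = sumSubsets n (λ X → ∣ X ∣ * f X)

-- Double counting of the pairs (X, v): v ∉ X is counted by the deletion sum, v ∈ X by the size weight.
deletionSum+sizeWeightedSum : ∀ n f → deletionSum n f + sizeWeightedSum (suc n) f ≡ suc n * sumSubsets (suc n) f
deletionSum+sizeWeightedSum zero f = count (f (false ∷ [])) (f (true ∷ []))
  where
  count : ∀ a b → a + 0 + 0 + (1 * b + (0 * a + 0)) ≡ 1 * (b + (a + 0))
  count = solve-∀
deletionSum+sizeWeightedSum (suc n) f = begin
  deletionSum (suc n) f + sizeWeightedSum (suc (suc n)) f
    ≡⟨ cong₂ _+_ (cong (A +_) deletionSum-split) sizeWeightedSum-split ⟩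
  A + (deletionSum n ft + deletionSum n ff) + (B + sizeWeightedSum (suc n) ft + sizeWeightedSum (suc n) ff)
    ≡⟨ regroup A B (deletionSum n ft) (deletionSum n ff) (sizeWeightedSum (suc n) ft) (sizeWeightedSum (suc n) ff) ⟩
  A + B + (deletionSum n ft + sizeWeightedSum (suc n) ft) + (deletionSum n ff + sizeWeightedSum (suc n) ff)
    ≡⟨ cong₂ (λ x y → A + B + x + y) (deletionSum+sizeWeightedSum n ft) (deletionSum+sizeWeightedSum n ff) ⟩
  A + B + suc n * B + suc n * A
    ≡⟨ collect A B (suc n) ⟩
  suc (suc n) * (B + A)
    ≡⟨ cong (suc (suc n) *_) (sumSubsets-suc (suc n) f) ⟨
  suc (suc n) * sumSubsets (suc (suc n)) f ∎
  where
  open ≡-Reasoning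
  ft ff : Subset (suc n) → ℕ
  ft X = f (true ∷ X)
  ff X = f (false ∷ X)
  A = sumSubsets (suc n) ff
  B = sumSubsets (suc n) ft
  deletionSum-split : sum (tabulate (λ w → sumSubsets (suc n) (λ X → f (insertAt X (suc w) false))))
                      ≡ deletionSum n ft + deletionSum n ff
  deletionSum-split = trans (cong sum (ListP.tabulate-cong (λ w → sumSubsets-suc n (λ X → f (insertAt X (suc w) false)))))
    (sum-tabulate-+ (λ w → sumSubsets n (λ Y → ft (insertAt Y w false))) (λ w → sumSubsets n (λ Y → ff (insertAt Y w false))))
  sizeWeightedSum-split : sizeWeightedSum (suc (suc n)) f ≡ B + sizeWeightedSum (suc n) ft + sizeWeightedSum (suc n) ff
  sizeWeightedSum-split = trans (sumSubsets-suc (suc n) _) (cong (_+ sizeWeightedSum (suc n) ff) (sum-map-+ (allSubsets (suc n)) ft (λ X → ∣ X ∣ * ft X)))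
  regroup : ∀ a b d₁ d₂ c₁ c₂ → a + (d₁ + d₂) + (b + c₁ + c₂) ≡ a + b + (d₁ + c₁) + (d₂ + c₂)
  regroup = solve-∀
  collect : ∀ a b m → a + b + m * b + m * a ≡ suc m * (b + a)
  collect = solve-∀

deleteVertex : ∀ {n} → Fin (suc n) → Graph (suc n) → Graph n
deleteVertex v G X = G (insertAt X v false)

block≡⇒part≡ : ∀ {n m} {V : Subset n} {part : Fin n → Fin m} {k} → block V part k ≡ V →
  ∀ x → lookup V x ≡ true → part x ≡ k
block≡⇒part≡ {V = V} {part} {k} blockₖ≡V x x∈V = does≡true⇒ (part x F.≟ k) (proj₂ (∧≡true⇒ {lookup V x}
  (trans (sym (lookup-block V part k x)) (trans (cong (λ W → lookup W x) blockₖ≡V) x∈V))))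

NoPointMassOnRecursivePart : ℕ → Pattern → Set
NoPointMassOnRecursivePart r P =
  ∀ k → k ∈ R P → ∀ k' → k' ≢ k → memE (pointMass r k) (E P) ≡ false

blowupEdge-inside-block : ∀ r P → NoPointMassOnRecursivePart r P →
  ∀ {n} {V : Subset n} {part} {k k'} → k ∈ R P → k' ≢ k → block V part k ≡ V →
  ∀ X → blowupEdge r P V part X ≡ false
blowupEdge-inside-block r P noPointMass {V = V} {part} {k} {k'} k∈R k'≢k blockₖ≡V X
  with blowupEdge r P V part X in isEdge
... | false = refl
... | true with ∧≡true⇒ isEdge
...   | ∣X∣≡r , rest with ∧≡true⇒ rest
...     | X⊆V , profile∈E = ⊥-elim (true≢false (trans (sym profile∈E) (trans
          (cong (λ w → memE w (E P)) (trans (profile-pointMass part X k X⊆Vₖ) (cong (λ c → pointMass c k) (≡ᵇ≡true⇒≡ ∣X∣≡r))))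
          (noPointMass k k∈R k' k'≢k))))
  where
  true≢false : true ≢ false
  true≢false ()
  X⊆Vₖ : ∀ x → lookup X x ≡ true → part x ≡ k
  X⊆Vₖ x x∈X = block≡⇒part≡ {part = part} blockₖ≡V x (⊆ᵇ≡true⇒ X V X⊆V x x∈X)

module _ (r : ℕ) {ℓ : ℕ} (Ps : Fin ℓ → Pattern) where

  Mix-cong : ∀ {n} {V : Subset n} {G G'} → Mix r Ps V G → (∀ X → G X ≡ G' X) → Mix r Ps V G'
  Mix-cong (edgeless G≡false) G≗G' = edgeless (λ X → trans (sym (G≗G' X)) (G≡false X))
  Mix-cong (step i part H block≢V mixH G≡) G≗G' = step i part H block≢V mixH (λ X → trans (sym (G≗G' X)) (G≡ X))

  Mix-edge : ∀ {n} {V : Subset n} {G} → Mix r Ps V G → ∀ X → G X ≡ true →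
    ∣ X ∣ ≡ r × (∀ x → lookup X x ≡ true → lookup V x ≡ true)
  Mix-edge (edgeless G≡false) X G≡true with trans (sym (G≡false X)) G≡true
  ... | ()
  Mix-edge {V = V} (step i part H block≢V mixH G≡) X G≡true with ∨≡true⇒ (trans (sym (G≡ X)) G≡true)
  ... | inj₁ isEdge = let (∣X∣≡r , rest) = ∧≡true⇒ isEdge in ≡ᵇ≡true⇒≡ ∣X∣≡r , ⊆ᵇ≡true⇒ X V (proj₁ (∧≡true⇒ rest))
  ... | inj₂ inUnion with any≡true⇒ _ (allFin _) inUnion
  ...   | j , jEdge with ∧≡true⇒ jEdge
  ...     | j∈R , HⱼX with Mix-edge (mixH j (VecP.lookup⇒[]= j (R (Ps i)) j∈R)) X HⱼX
  ...       | ∣X∣≡r , X⊆Vⱼ = ∣X∣≡r , λ x x∈X → proj₁ (∧≡true⇒ (trans (sym (lookup-block V part j x)) (X⊆Vⱼ x x∈X)))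

  unionR-inside-block : 0 < r → ∀ {n} {V : Subset n} {i} {part} {H} →
    (∀ j → j ∈ R (Ps i) → Mix r Ps (block V part j) (H j)) →
    ∀ {k} → k ∈ R (Ps i) → block V part k ≡ V → ∀ X → unionR (R (Ps i)) H X ≡ H k X
  unionR-inside-block r>0 {V = V} {i} {part} {H} mixH {k} k∈R blockₖ≡V X = ≡true⇔≡true⇒≡ only-k k-included
    where
    k-included : H k X ≡ true → unionR (R (Ps i)) H X ≡ true
    k-included HₖX = any-allFin≡true _ k (subst (λ b → (b ∧ H k X) ≡ true) (sym (VecP.[]=⇒lookup k∈R)) HₖX)
    only-k : unionR (R (Ps i)) H X ≡ true → H k X ≡ true
    only-k inUnion with any≡true⇒ _ (allFin _) inUnion
    ... | j , jEdge with ∧≡true⇒ jEdge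
    ...   | j∈R , HⱼX with j F.≟ k
    ...     | yes refl = HⱼX
    ...     | no j≢k with Mix-edge (mixH j (VecP.lookup⇒[]= j (R (Ps i)) j∈R)) X HⱼX
    ...       | ∣X∣≡r , X⊆Vⱼ = ⊥-elim (<⇒≢ r>0 (sym (trans (sym ∣X∣≡r) (∣∣≡0 X λ z z∈X →
                  let (z∈V , partz≡j) = ∧≡true⇒ (trans (sym (lookup-block V part j z)) (X⊆Vⱼ z z∈X))
                  in j≢k (trans (sym (does≡true⇒ (part z F.≟ j) partz≡j)) (block≡⇒part≡ {part = part} blockₖ≡V z z∈V))))))

  Mix-deleteVertex : 0 < r → (∀ i → NoPointMassOnRecursivePart r (Ps i)) →
    ∀ {n} {V : Subset (suc n)} {G} → Mix r Ps V G → (v : Fin (suc n)) →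
    Mix r Ps (removeAt V v) (deleteVertex v G)
  Mix-deleteVertex r>0 noPointMass (edgeless G≡false) v = edgeless (λ X → G≡false (insertAt X v false))
  Mix-deleteVertex r>0 noPointMass {n} {V} {G} (step i part H block≢V mixH G≡) v =
    deleted (FinP.any? (λ j → (j ∈? R (Ps i)) ×-dec (VecP.≡-dec Bool._≟_ (block V′ part′ j) V′)))
    where
    V′ = removeAt V v
    part′ = part ∘ punchIn v
    H′ : Fin (m (Ps i)) → Graph n
    H′ j = deleteVertex v (H j)
    mixH′ : ∀ j → j ∈ R (Ps i) → Mix r Ps (block V′ part′ j) (H′ j)
    mixH′ j j∈R = subst (λ W → Mix r Ps W (H′ j)) (sym (block-removeAt V part v j)) (Mix-deleteVertex r>0 noPointMass (mixH j j∈R) v)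
    G′≡ : ∀ X → deleteVertex v G X ≡ (blowupEdge r (Ps i) V′ part′ X ∨ unionR (R (Ps i)) H′ X)
    G′≡ X = trans (G≡ (insertAt X v false)) (cong (_∨ _) (blowupEdge-insertAt-false r (Ps i) V part X v))
    deleted : Dec (∃ λ j → j ∈ R (Ps i) × block V′ part′ j ≡ V′) → Mix r Ps V′ (deleteVertex v G)
    deleted (no none) = step i part′ H′ (λ j j∈R blockⱼ≡V′ → none (j , j∈R , blockⱼ≡V′)) mixH′ G′≡
    deleted (yes (k , k∈R , blockₖ≡V′)) =
      Mix-cong (subst (λ W → Mix r Ps W (H′ k)) blockₖ≡V′ (mixH′ k k∈R)) (λ X → sym (collapse X))
      where
      open ≡-Reasoning
      k′≢k : ∃ λ k′ → k′ ≢ k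
      k′≢k with block≢⇒∃-other-part V part k (block≢V k k∈R)
      ... | x , _ , part≢k = part x , part≢k
      collapse : ∀ X → deleteVertex v G X ≡ H′ k X
      collapse X = begin
        deleteVertex v G X                                        ≡⟨ G′≡ X ⟩
        blowupEdge r (Ps i) V′ part′ X ∨ unionR (R (Ps i)) H′ X   ≡⟨ cong₂ _∨_
          (blowupEdge-inside-block r (Ps i) (noPointMass i) {part = part′} k∈R (proj₂ k′≢k) blockₖ≡V′ X)
          (unionR-inside-block r>0 {part = part′} mixH′ k∈R blockₖ≡V′ X) ⟩
        false ∨ H′ k X                                            ∎

  sizeWeightedSum-edges : ∀ {n} {V : Subset n} {G : Graph n} → Mix r Ps V G →
    sizeWeightedSum n (indicator ∘ G) ≡ r * edges G
  sizeWeightedSum-edges {n} {G = G} mixG = trans (sum-map-cong (allSubsets n) weight≡r) (sum-map-*ˡ (allSubsets n) r _)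
    where
    weight≡r : ∀ X → ∣ X ∣ * indicator (G X) ≡ r * indicator (G X)
    weight≡r X with G X in X∈G
    ... | true = cong (_* 1) (proj₁ (Mix-edge mixG X X∈G))
    ... | false = trans (*-zeroʳ ∣ X ∣) (sym (*-zeroʳ r))

  deletionSum-edges : ∀ d {V : Subset (suc (r + d))} {G : Graph (suc (r + d))} → Mix r Ps V G →
    deletionSum (r + d) (indicator ∘ G) ≡ suc d * edges G
  deletionSum-edges d {G = G} mixG = +-cancelʳ-≡ (r * edges G) _ _ (begin
    deletionSum (r + d) (indicator ∘ G) + r * edges G
      ≡⟨ cong (deletionSum (r + d) (indicator ∘ G) +_) (sizeWeightedSum-edges mixG) ⟨
    deletionSum (r + d) (indicator ∘ G) + sizeWeightedSum (suc (r + d)) (indicator ∘ G)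
      ≡⟨ deletionSum+sizeWeightedSum (r + d) (indicator ∘ G) ⟩
    suc (r + d) * edges G
      ≡⟨ split r d (edges G) ⟩
    suc d * edges G + r * edges G ∎)
    where
    open ≡-Reasoning
    split : ∀ r d e → suc (r + d) * e ≡ suc d * e + r * e
    split = solve-∀

  module _ (r>0 : 0 < r) (noPointMass : ∀ i → NoPointMassOnRecursivePart r (Ps i)) where

    edges*C≤*C-step : ∀ d {G : Graph (suc (r + d))} → Mix r Ps ⊤ G → ∀ c K →
      (∀ v → edges (deleteVertex v G) * K ≤ c * ((r + d) C r)) → edges G * K ≤ c * (suc (r + d) C r)
    edges*C≤*C-step d {G} mixG c K G-v-bound = *-cancelˡ-≤ (suc d) (subst₂ _≤_ lhs≡ rhs≡ averaged)
      where
      n = r + d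
      averaged : deletionSum n (indicator ∘ G) * K ≤ suc n * (c * (n C r))
      averaged = sum-tabulate-*≤ (λ v → edges (deleteVertex v G)) K (c * (n C r)) G-v-bound
      lhs≡ : deletionSum n (indicator ∘ G) * K ≡ suc d * (edges G * K)
      lhs≡ = trans (cong (_* K) (deletionSum-edges d mixG)) (*-assoc (suc d) (edges G) K)
      rhs≡ : suc n * (c * (n C r)) ≡ suc d * (c * (suc n C r))
      rhs≡ = trans (x*[y*z]≡y*[x*z] (suc n) c (n C r))
        (trans (cong (c *_) ([1+r+d]*[r+d]Cr≡[1+d]*[1+r+d]Cr r d)) (x*[y*z]≡y*[x*z] c (suc d) _))
        where
        x*[y*z]≡y*[x*z] : ∀ x y z → x * (y * z) ≡ y * (x * z)
        x*[y*z]≡y*[x*z] = solve-∀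

    edges*C≤*C : ∀ {s c} → r ≤ s → (∀ G → Mix r Ps {s} ⊤ G → edges G ≤ c) →
      ∀ n → s ≤ n → ∀ G → Mix r Ps {n} ⊤ G → edges G * (s C r) ≤ c * (n C r)
    edges*C≤*C {s} r≤s Λs≤c n s≤n G mixG with m≤n⇒m<n∨m≡n s≤n
    ... | inj₂ refl = *-monoˡ-≤ (s C r) (Λs≤c G mixG)
    edges*C≤*C {s} {c} r≤s Λs≤c (suc n) _ G mixG | inj₁ (s≤s s≤n) with m≤n⇒∃[o]m+o≡n (≤-trans r≤s s≤n)
    ... | d , refl = edges*C≤*C-step d mixG c (s C r) λ v →
      edges*C≤*C r≤s Λs≤c (r + d) s≤n _
        (subst (λ W → Mix r Ps W (deleteVertex v G)) (removeAt-⊤ (r + d) v) (Mix-deleteVertex r>0 noPointMass mixG v))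

-- One vertex in V_k′ and the remaining n + 1 in the recursive part V_k (left edgeless):
-- if r·{k} is a profile of P, every r-subset of V_k is an edge.
pointMass-construction : ∀ r P {k k′} → k ∈ R P → k′ ≢ k → memE (pointMass r k) (E P) ≡ true →
  ∀ n → ∃ λ G → Mix r (single P) {suc (suc n)} ⊤ G × suc n C r ≤ edges G
pointMass-construction r P {k} {k′} k∈R k′≢k pointMass∈E n = G , mixG , C≤edges
  where
  part : Fin (suc (suc n)) → Fin (m P)
  part zero = k′
  part (suc x) = k
  H : Fin (m P) → Graph (suc (suc n))
  H _ _ = false
  G : Graph (suc (suc n))
  G X = blowupEdge r P ⊤ part X ∨ unionR (R P) H X
  true≢false : true ≢ false
  true≢false ()
  block≢⊤ : ∀ j → j ∈ R P → block ⊤ part j ≢ ⊤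
  block≢⊤ j _ blockⱼ≡⊤ with j F.≟ k
  ... | yes refl = true≢false (trans (sym (cong (λ W → lookup W zero) blockⱼ≡⊤))
          (trans (lookup-block ⊤ part k zero) (dec-false (k′ F.≟ k) k′≢k)))
  ... | no j≢k = true≢false (trans (sym (cong (λ W → lookup W (suc zero)) blockⱼ≡⊤))
          (trans (lookup-block ⊤ part j (suc zero)) (dec-false (k F.≟ j) (j≢k ∘ sym))))
  mixG : Mix r (single P) ⊤ G
  mixG = step zero part H block≢⊤ (λ j _ → edgeless λ _ → refl) (λ X → refl)
  inside-Vₖ : ∀ Y x → lookup (false ∷ Y) x ≡ true → part x ≡ k
  inside-Vₖ Y (suc x) _ = refl
  r-subset-is-edge : ∀ Y → (∣ Y ∣ ≡ᵇ r) ≡ true → G (false ∷ Y) ≡ true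
  r-subset-is-edge Y ∣Y∣≡r = cong (_∨ unionR (R P) H (false ∷ Y)) (cong₂ _∧_ ∣Y∣≡r (cong₂ _∧_ (⊆ᵇ⊤ (false ∷ Y))
    (trans (cong (λ w → memE w (E P))
      (trans (profile-pointMass part (false ∷ Y) k (inside-Vₖ Y)) (cong (λ c → pointMass c k) (≡ᵇ≡true⇒≡ {∣ Y ∣} ∣Y∣≡r))))
      pointMass∈E)))
  indicator-mono : ∀ Y → indicator (∣ Y ∣ ≡ᵇ r) ≤ indicator (G (false ∷ Y))
  indicator-mono Y = by-cases (∣ Y ∣ ≡ᵇ r) refl
    where
    by-cases : ∀ b → (∣ Y ∣ ≡ᵇ r) ≡ b → indicator b ≤ indicator (G (false ∷ Y))
    by-cases false _ = z≤n
    by-cases true ∣Y∣≡r = subst (λ b → 1 ≤ indicator b) (sym (r-subset-is-edge Y ∣Y∣≡r)) ≤-refl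
  C≤edges : suc n C r ≤ edges G
  C≤edges = begin
    suc n C r                                                  ≡⟨ sumSubsets-size≡C (suc n) r ⟨
    sumSubsets (suc n) (λ Y → indicator (∣ Y ∣ ≡ᵇ r))          ≤⟨ sum-map-mono (allSubsets (suc n)) indicator-mono ⟩
    sumSubsets (suc n) (indicator ∘ G ∘ (false ∷_))            ≤⟨ m≤n+m _ _ ⟩
    sumSubsets (suc n) (indicator ∘ G ∘ (true ∷_)) + sumSubsets (suc n) (indicator ∘ G ∘ (false ∷_))
      ≡⟨ sumSubsets-suc (suc n) (indicator ∘ G) ⟨
    edges G                                                    ∎
    where open ≤-Reasoning

-- C(n, r) / C(n + 1, r) = (n + 1 − r) / (n + 1) exceeds 1 − 1/q as soon as n + 1 > r q.
q*nCr+[1+n]Cr≰q*[1+n]Cr : ∀ q n r′ → r′ ≤ n → suc r′ * q < suc n →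
  ¬ (q * (n C suc r′) + suc n C suc r′ ≤ q * (suc n C suc r′))
q*nCr+[1+n]Cr≰q*[1+n]Cr q n r′ r′≤n rq<1+n ratio≤ =
  <⇒≱ rq<1+n (*-cancelʳ-≤ (suc n) (suc r′ * q) (n C r′) {{>-nonZero (nCk>0 r′≤n)}} scaled)
  where
  Pascal : suc n C suc r′ ≡ n C r′ + n C suc r′
  Pascal = sym (nCk+nC[k+1]≡[n+1]C[k+1] n r′)
  C≤qC : suc n C suc r′ ≤ q * (n C r′)
  C≤qC = +-cancelˡ-≤ (q * (n C suc r′)) _ _ (begin
    q * (n C suc r′) + suc n C suc r′       ≤⟨ ratio≤ ⟩
    q * (suc n C suc r′)                    ≡⟨ cong (q *_) Pascal ⟩
    q * (n C r′ + n C suc r′)               ≡⟨ *-distribˡ-+ q _ _ ⟩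
    q * (n C r′) + q * (n C suc r′)         ≡⟨ +-comm (q * (n C r′)) _ ⟩
    q * (n C suc r′) + q * (n C r′)         ∎)
    where open ≤-Reasoning
  scaled : suc n * (n C r′) ≤ suc r′ * q * (n C r′)
  scaled = begin
    suc n * (n C r′)                        ≡⟨ [1+k]*[1+n]C[1+k]≡[1+n]*nCk n r′ ⟨
    suc r′ * (suc n C suc r′)               ≤⟨ *-monoʳ-≤ (suc r′) C≤qC ⟩
    suc r′ * (q * (n C r′))                 ≡⟨ *-assoc (suc r′) q _ ⟨
    suc r′ * q * (n C r′)                   ∎
    where open ≤-Reasoning

¬¬-greatest≤ : (S : ℕ → Set) → S 0 → ∀ k → ¬ ¬ (∃ λ a → S a × (∀ c → S c → c ≤ k → c ≤ a))
¬¬-greatest≤ S S0 zero no-greatest = no-greatest (0 , S0 , λ c _ c≤0 → c≤0)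
¬¬-greatest≤ S S0 (suc k) no-greatest = ¬¬-greatest≤ S S0 k λ { (a , Sa , a-greatest) → ¬¬-excluded-middle λ
  { (yes S[1+k]) → no-greatest (suc k , S[1+k] , λ c _ c≤1+k → c≤1+k)
  ; (no ¬S[1+k]) → no-greatest (a , Sa , λ c Sc c≤1+k → below a Sc c≤1+k ¬S[1+k] a-greatest) } }
  where
  below : ∀ a {c} → S c → c ≤ suc k → ¬ S (suc k) → (∀ c → S c → c ≤ k → c ≤ a) → c ≤ a
  below a {c} Sc c≤1+k ¬S[1+k] a-greatest with m≤n⇒m<n∨m≡n c≤1+k
  ... | inj₁ (s≤s c≤k) = a-greatest c Sc c≤k
  ... | inj₂ refl = ⊥-elim (¬S[1+k] Sc)

-- Mix is not decidable, so the maximum Λ(n) exists only up to double negation.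
¬¬-IsΛ : ∀ r {ℓ} (Ps : Fin ℓ → Pattern) n → ¬ ¬ (∃ λ a → IsΛ r Ps n a)
¬¬-IsΛ r Ps n no-Λ = ¬¬-greatest≤ achieved achieved-0 (length (allSubsets n)) λ { (a , achieved-a , a-greatest) →
  no-Λ (a , achieved-a , λ G mixG → a-greatest (edges G) (G , mixG , refl) (sum-map-indicator≤length (allSubsets n) G)) }
  where
  achieved : ℕ → Set
  achieved c = ∃ λ G → Mix r Ps {n} ⊤ G × edges G ≡ c
  achieved-0 : achieved 0
  achieved-0 = (λ _ → false) , edgeless (λ _ → refl) , sum-map-zero (allSubsets n)

LagLt1⇒NoPointMassOnRecursivePart : ∀ r → 0 < r → ∀ P → LagLt1 r P → NoPointMassOnRecursivePart r P
LagLt1⇒NoPointMassOnRecursivePart r@(suc r′) _ P (q , 1≤q , N , λ<1) k k∈R k′ k′≢k with memE (pointMass r k) (E P) in pointMass∈E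
... | false = refl
... | true = ⊥-elim (¬¬-IsΛ r (single P) (suc (suc n)) λ { (a , Λ) → contradiction a Λ })
  where
  n = N + q * r
  contradiction : ∀ a → IsΛ r (single P) (suc (suc n)) a → ⊥
  contradiction a Λ@(_ , Λ-max) with pointMass-construction r P k∈R k′≢k pointMass∈E n
  ... | G , mixG , C≤edges = q*nCr+[1+n]Cr≰q*[1+n]Cr q (suc n) r′ r′≤1+n rq<2+n (begin
    q * (suc n C r) + suc (suc n) C r      ≤⟨ +-monoˡ-≤ _ (*-monoʳ-≤ q (≤-trans C≤edges (Λ-max G mixG))) ⟩
    q * a + suc (suc n) C r                ≤⟨ λ<1 (suc (suc n)) N≤2+n a Λ ⟩
    q * (suc (suc n) C r)                  ∎)
    where
    open ≤-Reasoning
    qr≤n : q * r ≤ n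
    qr≤n = m≤n+m (q * r) N
    rq<2+n : r * q < suc (suc n)
    rq<2+n = s≤s (≤-trans (≤-reflexive (*-comm r q)) (≤-trans qr≤n (n≤1+n n)))
    N≤2+n : N ≤ suc (suc n)
    N≤2+n = ≤-trans (m≤m+n N _) (≤-trans (n≤1+n _) (n≤1+n _))
    r′≤1+n : r′ ≤ suc n
    r′≤1+n = ≤-trans (n≤1+n r′) (≤-trans (≤-trans (m≤n*m r q {{>-nonZero 1≤q}}) qr≤n) (n≤1+n n))

-- Of the standing assumptions only r > 0 and λ_{P_i} < 1 enter this averaging argument.
lemma3p3 : (r : ℕ) → 3 ≤ r → (k : ℕ) → 1 ≤ k → (Ps : Fin k → Pattern) →
    (∀ i → IsRPattern r (Ps i)) →
    (∀ i j → i ≢ j → ¬ PatIso (Ps i) (Ps j)) →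
    (∀ i → Minimal r (Ps i)) →
    (∀ i → LagPos r (Ps i)) →
    (∀ i → LagLt1 r (Ps i)) →
    (s t : ℕ) → r ≤ s → s ≤ t →
    (a b : ℕ) → IsΛ r Ps s a → IsΛ r Ps t b →
    b * (s C r) ≤ a * (t C r)
lemma3p3 r 3≤r k _ Ps _ _ _ _ λ<1 s t r≤s s≤t a b (_ , Λs-max) ((G , mixG , edges≡b) , _) =
  subst (λ e → e * (s C r) ≤ a * (t C r)) edges≡b
    (edges*C≤*C r Ps r>0 noPointMass r≤s Λs-max t s≤t G mixG)
  where
  r>0 : 0 < r
  r>0 = ≤-trans (s≤s z≤n) 3≤r
  noPointMass : ∀ i → NoPointMassOnRecursivePart r (Ps i)
  noPointMass i = LagLt1⇒NoPointMassOnRecursivePart r r>0 (Ps i) (λ<1 i)
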